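{- If $n$ is a positive integer, then \[ \sum_{k = 1}^n \sum_{j = 0}^{k - 1} \frac{( - 1)^{n - j} \left( n - j \right)!}{\left( n - j + 1 \right)\left( k - j \right)}\left\{ n \atop n - j \right\} = - \frac{n}{2}B_{n - 1} . \]
   Context: $\left\{ n \atop m\right\}$ denotes the Stirling number of the second kind. $B_n$ are the Bernoulli numbers defined by $\frac{t}{e^t-1}=\sum_{n\ge0}B_n\frac{t^n}{n!}$ (so $B_0=1$, $B_1=-\tfrac12$). -}

module Defs where

open import Data.Nat as ℕ using (ℕ; zero; suc)
open import Data.Nat.Combinatorics using (_C_)
open import Data.Integer as ℤ using (ℤ; +_)
open import Data.Rational as ℚ using (ℚ; _+_; _*_; -_; _/_)
open import Data.List using (List; []; _∷_; _∷ʳ_; zip; upTo; map; foldr; length)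

stirling2 : ℕ → ℕ → ℕ
stirling2 zero    zero    = 1
stirling2 zero    (suc m) = 0
stirling2 (suc n) zero    = 0
stirling2 (suc n) (suc m) = suc m ℕ.* stirling2 n (suc m) ℕ.+ stirling2 n m

sumTo : ℕ → (ℕ → ℚ) → ℚ
sumTo zero f = ℚ.0ℚ
sumTo (suc n) f = (sumTo n f) + f n

sgn : ℕ → ℚ
sgn zero    = ℚ.1ℚ
sgn (suc k) = - sgn k

-- Bernoulli numbers with B₁ = -1/2, i.e. t/(e^t - 1) = Σ Bₙ tⁿ/n!.
-- Equivalent to the recurrence  Σ_{k=0}^{m} C(m+1,k) B_k = 0 for m ≥ 1, B₀ = 1,
-- i.e.  B_m = - 1/(m+1) Σ_{k<m} C(m+1,k) B_k.
-- bernoulliList m = [B₀, …, B_m]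
private
  step : ℕ → List ℚ → ℚ
  step m bs = - ((+ 1 / suc m) * foldr _+_ ℚ.0ℚ
                  (map (λ p → (+ ((suc m) C (Data.Product.proj₁ p)) / 1) * Data.Product.proj₂ p)
                       (zip (upTo m) bs)))
    where import Data.Product

bernoulliList : ℕ → List ℚ
bernoulliList zero    = ℚ.1ℚ ∷ []
bernoulliList (suc m) = let bs = bernoulliList m in bs ∷ʳ step (suc m) bs

last : List ℚ → ℚ
last []           = ℚ.0ℚ
last (x ∷ [])     = x
last (x ∷ y ∷ xs) = last (y ∷ xs)

bernoulli : ℕ → ℚ
bernoulli m = last (bernoulliList m)

{-# OPTIONS --safe #-}

-- Write T(n,m) = (-1)^m m! S(n,m) and let D act on rational sequences by
-- (D x)_m = m x_m - (m+1) x_(m+1).  The recurrence for S(n,m) gives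
-- Σ_m T(n,m) x_m = (Dⁿ x)_0.  After exchanging the order of summation, the
-- left-hand side is this transform of y_m = H_m / (m+1), H the harmonic numbers;
-- call it c_n.  The backward difference E satisfies D E = E (D + 1), hence
-- (Dᴺ E y)_0 = Σ_k C(N,k) c_k; and E y - y is annihilated by D³, so
-- Σ_(k<N) C(N,k) c_k = 0 for N ≥ 3.  This is the Bernoulli recurrence for
-- b_k = -2 c_(k+1) / (k+1), whence c_n = -(n/2) B_(n-1).

module Submission where

open import Defs
open import Data.Nat as ℕ using (ℕ; zero; suc; _∸_; _!)
open import Data.Nat.Combinatorics using (_C_; nCk+nC[k+1]≡[n+1]C[k+1]; k>n⇒nCk≡0; nCn≡1; nC1≡n; nCk≡nC[n∸k])
import Data.Nat.Properties as ℕₚ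
import Data.Nat.Tactic.RingSolver as ℕ-Solver
open import Data.Integer as ℤ using (ℤ; +_)
import Data.Integer.Tactic.RingSolver as ℤ-Solver
import Data.Integer.Properties as ℤₚ
open import Data.Rational using (ℚ; _+_; _*_; -_; _-_; _/_; 0ℚ; 1ℚ; toℚᵘ)
open import Data.Rational.Properties
open import Data.Rational.Unnormalised as ℚᵘ using (mkℚᵘ; *≡*) renaming (_≃_ to _≃ᵘ_)
import Data.Rational.Unnormalised.Properties as ℚᵘₚ
open import Data.List using (List; []; _∷_; _∷ʳ_; zip; upTo; map; foldr; applyUpTo)
open import Data.List.Properties using (applyUpTo-∷ʳ)
open import Data.Product using (proj₁; proj₂)
open import Function using (_∘_)
open import Level using (0ℓ)
open import Relation.Binary.PropositionalEquality
open import Relation.Nullary.Decidable using (dec⇒maybe)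
open import Tactic.RingSolver using (solve-∀)
open import Tactic.RingSolver.Core.AlmostCommutativeRing using (AlmostCommutativeRing; fromCommutativeRing)

ℚ-ring : AlmostCommutativeRing 0ℓ 0ℓ
ℚ-ring = fromCommutativeRing +-*-commutativeRing (λ p → dec⇒maybe (0ℚ ≟ p))

ι : ℕ → ℚ
ι a = + a / 1

1/ι : (a : ℕ) → .{{ℕ.NonZero a}} → ℚ
1/ι a = + 1 / a

toℚᵘ-/ : ∀ a d → toℚᵘ (+ a / suc d) ≃ᵘ mkℚᵘ (+ a) d
toℚᵘ-/ a d = toℚᵘ-fromℚᵘ (mkℚᵘ (+ a) d)

ι-suc : ∀ a → ι (suc a) ≡ 1ℚ + ι a
ι-suc a = toℚᵘ-injective (begin
  toℚᵘ (ι (suc a))                   ≈⟨ toℚᵘ-/ (suc a) 0 ⟩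
  mkℚᵘ (+ suc a) 0                   ≈⟨ *≡* (trans (cong (ℤ._* (+ 1 ℤ.* + 1)) (ℤₚ.pos-+ 1 a)) (numerator (+ a))) ⟩
  mkℚᵘ (+ 1) 0 ℚᵘ.+ mkℚᵘ (+ a) 0     ≈⟨ ℚᵘₚ.+-cong (toℚᵘ-/ 1 0) (toℚᵘ-/ a 0) ⟨
  toℚᵘ 1ℚ ℚᵘ.+ toℚᵘ (ι a)            ≈⟨ toℚᵘ-homo-+ 1ℚ (ι a) ⟨
  toℚᵘ (1ℚ + ι a)                    ∎)
  where
  open ℚᵘₚ.≃-Reasoning
  numerator : ∀ (i : ℤ) → (+ 1 ℤ.+ i) ℤ.* (+ 1 ℤ.* + 1) ≡ (+ 1 ℤ.* + 1 ℤ.+ i ℤ.* + 1) ℤ.* + 1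
  numerator = ℤ-Solver.solve-∀

ι-+ : ∀ a b → ι (a ℕ.+ b) ≡ ι a + ι b
ι-+ zero    b = sym (+-identityˡ (ι b))
ι-+ (suc a) b = begin
  ι (suc (a ℕ.+ b))   ≡⟨ ι-suc (a ℕ.+ b) ⟩
  1ℚ + ι (a ℕ.+ b)    ≡⟨ cong (λ s → 1ℚ + s) (ι-+ a b) ⟩
  1ℚ + (ι a + ι b)    ≡⟨ +-assoc 1ℚ (ι a) (ι b) ⟨
  (1ℚ + ι a) + ι b    ≡⟨ cong (_+ ι b) (ι-suc a) ⟨
  ι (suc a) + ι b     ∎
  where open ≡-Reasoning

ι-* : ∀ a b → ι (a ℕ.* b) ≡ ι a * ι b
ι-* zero    b = sym (*-zeroˡ (ι b))
ι-* (suc a) b = begin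
  ι (b ℕ.+ a ℕ.* b)     ≡⟨ ι-+ b (a ℕ.* b) ⟩
  ι b + ι (a ℕ.* b)     ≡⟨ cong (λ s → ι b + s) (ι-* a b) ⟩
  ι b + ι a * ι b       ≡⟨ cong (_+ ι a * ι b) (*-identityˡ (ι b)) ⟨
  1ℚ * ι b + ι a * ι b  ≡⟨ *-distribʳ-+ (ι b) 1ℚ (ι a) ⟨
  (1ℚ + ι a) * ι b      ≡⟨ cong (_* ι b) (ι-suc a) ⟨
  ι (suc a) * ι b       ∎
  where open ≡-Reasoning

ι-*-1/ι : ∀ a → ι (suc a) * 1/ι (suc a) ≡ 1ℚ
ι-*-1/ι a = toℚᵘ-injective (begin
  toℚᵘ (ι (suc a) * 1/ι (suc a))               ≈⟨ toℚᵘ-homo-* (ι (suc a)) (1/ι (suc a)) ⟩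
  toℚᵘ (ι (suc a)) ℚᵘ.* toℚᵘ (1/ι (suc a))     ≈⟨ ℚᵘₚ.*-cong (toℚᵘ-/ (suc a) 0) (toℚᵘ-/ 1 a) ⟩
  mkℚᵘ (+ suc a) 0 ℚᵘ.* mkℚᵘ (+ 1) a           ≈⟨ ℚᵘₚ.*-inverseʳ (mkℚᵘ (+ suc a) 0) ⟩
  ℚᵘ.1ℚᵘ                                       ≈⟨ toℚᵘ-/ 1 0 ⟨
  toℚᵘ 1ℚ                                      ∎)
  where open ℚᵘₚ.≃-Reasoning

1/ι-* : ∀ a b → 1/ι (suc a ℕ.* suc b) ≡ 1/ι (suc a) * 1/ι (suc b)
1/ι-* a b = toℚᵘ-injective (begin
  toℚᵘ (1/ι (suc a ℕ.* suc b))                 ≈⟨ toℚᵘ-/ 1 (b ℕ.+ a ℕ.* suc b) ⟩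
  mkℚᵘ (+ 1) a ℚᵘ.* mkℚᵘ (+ 1) b               ≈⟨ ℚᵘₚ.*-cong (toℚᵘ-/ 1 a) (toℚᵘ-/ 1 b) ⟨
  toℚᵘ (1/ι (suc a)) ℚᵘ.* toℚᵘ (1/ι (suc b))   ≈⟨ toℚᵘ-homo-* (1/ι (suc a)) (1/ι (suc b)) ⟨
  toℚᵘ (1/ι (suc a) * 1/ι (suc b))             ∎)
  where open ℚᵘₚ.≃-Reasoning

/≡ι*1/ι : ∀ a d → + a / suc d ≡ ι a * 1/ι (suc d)
/≡ι*1/ι a d = toℚᵘ-injective (begin
  toℚᵘ (+ a / suc d)                           ≈⟨ toℚᵘ-/ a d ⟩
  mkℚᵘ (+ a) d                                 ≈⟨ *≡* cross ⟩
  mkℚᵘ (+ a) 0 ℚᵘ.* mkℚᵘ (+ 1) d               ≈⟨ ℚᵘₚ.*-cong (toℚᵘ-/ a 0) (toℚᵘ-/ 1 d) ⟨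
  toℚᵘ (ι a) ℚᵘ.* toℚᵘ (1/ι (suc d))           ≈⟨ toℚᵘ-homo-* (ι a) (1/ι (suc d)) ⟨
  toℚᵘ (ι a * 1/ι (suc d))                     ∎)
  where
  open ℚᵘₚ.≃-Reasoning
  cross : + a ℤ.* + suc (d ℕ.+ 0) ≡ (+ a ℤ.* + 1) ℤ.* + suc d
  cross = trans (cong (λ k → + a ℤ.* + suc k) (ℕₚ.+-identityʳ d)) (cong (ℤ._* + suc d) (sym (ℤₚ.*-identityʳ (+ a))))

/-cross : ∀ {p q d e} → p ℕ.* suc e ≡ q ℕ.* suc d → + p / suc d ≡ + q / suc e
/-cross {p} {q} {d} {e} eq = toℚᵘ-injective (begin
  toℚᵘ (+ p / suc d)    ≈⟨ toℚᵘ-/ p d ⟩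
  mkℚᵘ (+ p) d          ≈⟨ *≡* (trans (sym (ℤₚ.pos-* p (suc e))) (trans (cong +_ eq) (ℤₚ.pos-* q (suc d)))) ⟩
  mkℚᵘ (+ q) e          ≈⟨ toℚᵘ-/ q e ⟨
  toℚᵘ (+ q / suc e)    ∎)
  where open ℚᵘₚ.≃-Reasoning

s+ax≡0⇒x≡-a⁻¹s : ∀ {a a⁻¹ s x} → a * a⁻¹ ≡ 1ℚ → s + a * x ≡ 0ℚ → x ≡ - (a⁻¹ * s)
s+ax≡0⇒x≡-a⁻¹s {a} {a⁻¹} {s} {x} aa⁻¹≡1 s+ax≡0 = begin
  x
    ≡⟨ expand a a⁻¹ s x ⟩
  - (a⁻¹ * s) + a⁻¹ * (s + a * x) + (1ℚ - a * a⁻¹) * x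
    ≡⟨ cong₂ (λ u v → - (a⁻¹ * s) + a⁻¹ * u + (1ℚ - v) * x) s+ax≡0 aa⁻¹≡1 ⟩
  - (a⁻¹ * s) + a⁻¹ * 0ℚ + (1ℚ - 1ℚ) * x
    ≡⟨ simplify a⁻¹ s x ⟩
  - (a⁻¹ * s)
    ∎
  where
  open ≡-Reasoning
  expand : ∀ a a⁻¹ s x → x ≡ - (a⁻¹ * s) + a⁻¹ * (s + a * x) + (1ℚ - a * a⁻¹) * x
  expand = solve-∀ ℚ-ring
  simplify : ∀ a⁻¹ s x → - (a⁻¹ * s) + a⁻¹ * 0ℚ + (1ℚ - 1ℚ) * x ≡ - (a⁻¹ * s)
  simplify = solve-∀ ℚ-ring

[n+1]Cn≡n+1 : ∀ n → suc n C n ≡ suc n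
[n+1]Cn≡n+1 n = trans (nCk≡nC[n∸k] (ℕₚ.n≤1+n n)) (trans (cong (suc n C_) (ℕₚ.m+n∸n≡m 1 n)) (nC1≡n (suc n)))

[k+1]*[n+1]C[k+1]≡[n+1]*nCk : ∀ n k → suc k ℕ.* (suc n C suc k) ≡ suc n ℕ.* (n C k)
[k+1]*[n+1]C[k+1]≡[n+1]*nCk zero    zero    = refl
[k+1]*[n+1]C[k+1]≡[n+1]*nCk zero    (suc k) rewrite k>n⇒nCk≡0 {0} {suc k} (ℕ.s≤s ℕ.z≤n) = ℕₚ.*-zeroʳ (suc (suc k))
[k+1]*[n+1]C[k+1]≡[n+1]*nCk (suc n) zero    =
  trans (ℕₚ.*-identityˡ _) (trans (nC1≡n (suc (suc n))) (sym (ℕₚ.*-identityʳ (suc (suc n)))))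
[k+1]*[n+1]C[k+1]≡[n+1]*nCk (suc n) (suc k) = begin
  suc (suc k) ℕ.* (suc (suc n) C suc (suc k))
    ≡⟨ cong (suc (suc k) ℕ.*_) (nCk+nC[k+1]≡[n+1]C[k+1] (suc n) (suc k)) ⟨
  suc (suc k) ℕ.* (a ℕ.+ b)
    ≡⟨ expand (suc k) a b ⟩
  a ℕ.+ (suc k ℕ.* a ℕ.+ suc (suc k) ℕ.* b)
    ≡⟨ cong₂ (λ s t → a ℕ.+ (s ℕ.+ t)) ([k+1]*[n+1]C[k+1]≡[n+1]*nCk n k) ([k+1]*[n+1]C[k+1]≡[n+1]*nCk n (suc k)) ⟩
  a ℕ.+ (suc n ℕ.* (n C k) ℕ.+ suc n ℕ.* (n C suc k))
    ≡⟨ cong (a ℕ.+_) (ℕₚ.*-distribˡ-+ (suc n) (n C k) (n C suc k)) ⟨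
  a ℕ.+ suc n ℕ.* (n C k ℕ.+ n C suc k)
    ≡⟨ cong (λ t → a ℕ.+ suc n ℕ.* t) (nCk+nC[k+1]≡[n+1]C[k+1] n k) ⟩
  suc (suc n) ℕ.* a
    ∎
  where
  open ≡-Reasoning
  a = suc n C suc k
  b = suc n C suc (suc k)
  expand : ∀ k a b → suc k ℕ.* (a ℕ.+ b) ≡ a ℕ.+ (k ℕ.* a ℕ.+ suc k ℕ.* b)
  expand = ℕ-Solver.solve-∀

ι-C-absorption : ∀ n k → ι (n C k) * 1/ι (suc k) ≡ ι (suc n C suc k) * 1/ι (suc n)
ι-C-absorption n k = begin
  ι (n C k) * 1/ι (suc k)           ≡⟨ /≡ι*1/ι (n C k) k ⟨
  + (n C k) / suc k                 ≡⟨ /-cross {n C k} {suc n C suc k} {k} {n} cross ⟩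
  + (suc n C suc k) / suc n         ≡⟨ /≡ι*1/ι (suc n C suc k) n ⟩
  ι (suc n C suc k) * 1/ι (suc n)   ∎
  where
  open ≡-Reasoning
  cross : (n C k) ℕ.* suc n ≡ (suc n C suc k) ℕ.* suc k
  cross = trans (ℕₚ.*-comm (n C k) (suc n)) (trans (sym ([k+1]*[n+1]C[k+1]≡[n+1]*nCk n k)) (ℕₚ.*-comm (suc k) (suc n C suc k)))

sumTo-cong-< : ∀ n {f g : ℕ → ℚ} → (∀ i → i ℕ.< n → f i ≡ g i) → sumTo n f ≡ sumTo n g
sumTo-cong-< zero    f≡g = refl
sumTo-cong-< (suc n) f≡g = cong₂ _+_ (sumTo-cong-< n (λ i i<n → f≡g i (ℕₚ.m<n⇒m<1+n i<n))) (f≡g n ℕₚ.≤-refl)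

sumTo-cong : ∀ n {f g : ℕ → ℚ} → f ≗ g → sumTo n f ≡ sumTo n g
sumTo-cong n f≗g = sumTo-cong-< n (λ i _ → f≗g i)

sumTo-+ : ∀ n (f g : ℕ → ℚ) → sumTo n (λ i → f i + g i) ≡ sumTo n f + sumTo n g
sumTo-+ zero    f g = refl
sumTo-+ (suc n) f g = trans (cong (_+ (f n + g n)) (sumTo-+ n f g)) (interchange (sumTo n f) (sumTo n g) (f n) (g n))
  where
  interchange : ∀ a b c d → (a + b) + (c + d) ≡ (a + c) + (b + d)
  interchange = solve-∀ ℚ-ring

sumTo-neg : ∀ n (f : ℕ → ℚ) → sumTo n (λ i → - f i) ≡ - sumTo n f
sumTo-neg zero    f = refl
sumTo-neg (suc n) f = trans (cong (_+ (- f n)) (sumTo-neg n f)) (sym (neg-distrib-+ (sumTo n f) (f n)))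

sumTo-- : ∀ n (f g : ℕ → ℚ) → sumTo n (λ i → f i - g i) ≡ sumTo n f - sumTo n g
sumTo-- n f g = trans (sumTo-+ n f (λ i → - g i)) (cong (λ s → sumTo n f + s) (sumTo-neg n g))

sumTo-*ˡ : ∀ n c (f : ℕ → ℚ) → sumTo n (λ i → c * f i) ≡ c * sumTo n f
sumTo-*ˡ zero    c f = sym (*-zeroʳ c)
sumTo-*ˡ (suc n) c f = trans (cong (_+ c * f n) (sumTo-*ˡ n c f)) (sym (*-distribˡ-+ c (sumTo n f) (f n)))

sumTo-head : ∀ n (f : ℕ → ℚ) → sumTo (suc n) f ≡ f 0 + sumTo n (f ∘ suc)
sumTo-head zero    f = trans (+-identityˡ (f 0)) (sym (+-identityʳ (f 0)))
sumTo-head (suc n) f = trans (cong (_+ f (suc n)) (sumTo-head n f)) (+-assoc (f 0) _ _)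

sumTo-∘suc : ∀ n (f : ℕ → ℚ) → f 0 ≡ 0ℚ → f n ≡ 0ℚ → sumTo n (f ∘ suc) ≡ sumTo n f
sumTo-∘suc n f f0≡0 fn≡0 = begin
  sumTo n (f ∘ suc)            ≡⟨ +-identityˡ _ ⟨
  0ℚ + sumTo n (f ∘ suc)       ≡⟨ cong (_+ sumTo n (f ∘ suc)) f0≡0 ⟨
  f 0 + sumTo n (f ∘ suc)      ≡⟨ sumTo-head n f ⟨
  sumTo n f + f n              ≡⟨ cong (λ s → sumTo n f + s) fn≡0 ⟩
  sumTo n f + 0ℚ               ≡⟨ +-identityʳ _ ⟩
  sumTo n f                    ∎
  where open ≡-Reasoning

sumTo-triangle : ∀ n (f : ℕ → ℕ → ℚ) →
  sumTo n (λ i → sumTo (suc i) (λ j → f j (i ∸ j))) ≡ sumTo n (λ j → sumTo (n ∸ j) (f j))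
sumTo-triangle zero    f = refl
sumTo-triangle (suc n) f = begin
  sumTo n (λ i → sumTo (suc i) (λ j → f j (i ∸ j))) + sumTo (suc n) diagonal
    ≡⟨ cong (_+ sumTo (suc n) diagonal) (sumTo-triangle n f) ⟩
  sumTo n rows + sumTo (suc n) diagonal
    ≡⟨ cong (_+ sumTo (suc n) diagonal) (+-identityʳ (sumTo n rows)) ⟨
  sumTo n rows + sumTo 0 (f n) + sumTo (suc n) diagonal
    ≡⟨ cong (λ k → sumTo n rows + sumTo k (f n) + sumTo (suc n) diagonal) (ℕₚ.n∸n≡0 n) ⟨
  sumTo (suc n) rows + sumTo (suc n) diagonal
    ≡⟨ sumTo-+ (suc n) rows diagonal ⟨
  sumTo (suc n) (λ j → rows j + diagonal j)
    ≡⟨ sumTo-cong-< (suc n) (λ j j≤n → cong (λ k → sumTo k (f j)) (ℕₚ.+-∸-assoc 1 (ℕₚ.≤-pred j≤n))) ⟨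
  sumTo (suc n) (λ j → sumTo (suc n ∸ j) (f j))
    ∎
  where
  open ≡-Reasoning
  rows diagonal : ℕ → ℚ
  rows j = sumTo (n ∸ j) (f j)
  diagonal j = f j (n ∸ j)

sumTo-reflect : ∀ n (f : ℕ → ℚ) → sumTo n (λ j → f (n ∸ j)) ≡ sumTo n (f ∘ suc)
sumTo-reflect zero    f = refl
sumTo-reflect (suc n) f = begin
  sumTo n (λ j → f (suc n ∸ j)) + f (suc n ∸ n)
    ≡⟨ cong₂ _+_ (sumTo-cong-< n (λ j j<n → cong f (ℕₚ.+-∸-assoc 1 (ℕₚ.<⇒≤ j<n))))
                 (cong f (ℕₚ.m+n∸n≡m 1 n)) ⟩
  sumTo n (λ j → f (suc (n ∸ j))) + f 1
    ≡⟨ cong (_+ f 1) (sumTo-reflect n (f ∘ suc)) ⟩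
  sumTo n (f ∘ suc ∘ suc) + f 1
    ≡⟨ +-comm _ (f 1) ⟩
  f 1 + sumTo n (f ∘ suc ∘ suc)
    ≡⟨ sumTo-head n (f ∘ suc) ⟨
  sumTo (suc n) (f ∘ suc)
    ∎
  where open ≡-Reasoning

pascal-sum : ∀ N (a : ℕ → ℚ) →
  sumTo (suc (suc N)) (λ k → ι (suc N C k) * a k) ≡ sumTo (suc N) (λ k → ι (N C k) * (a (suc k) + a k))
pascal-sum N a = begin
  sumTo (suc (suc N)) (λ k → ι (suc N C k) * a k)        ≡⟨ sumTo-head (suc N) _ ⟩
  g 0 + sumTo (suc N) (λ k → ι (suc N C suc k) * a (suc k)) ≡⟨ cong (λ s → g 0 + s) (sumTo-cong (suc N) split) ⟩
  g 0 + sumTo (suc N) (λ k → h k + g (suc k))             ≡⟨ cong (λ s → g 0 + s) (sumTo-+ (suc N) h (g ∘ suc)) ⟩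
  g 0 + (sumTo (suc N) h + sumTo (suc N) (g ∘ suc))       ≡⟨ +-comm-middle (g 0) (sumTo (suc N) h) _ ⟩
  sumTo (suc N) h + (g 0 + sumTo (suc N) (g ∘ suc))       ≡⟨ cong (λ s → sumTo (suc N) h + s) prepend-g0 ⟩
  sumTo (suc N) h + sumTo (suc N) g                       ≡⟨ sumTo-+ (suc N) h g ⟨
  sumTo (suc N) (λ k → h k + g k)                         ≡⟨ sumTo-cong (suc N) (λ k → *-distribˡ-+ (ι (N C k)) _ _) ⟨
  sumTo (suc N) (λ k → ι (N C k) * (a (suc k) + a k))     ∎
  where
  open ≡-Reasoning
  g h : ℕ → ℚ
  g k = ι (N C k) * a k
  h k = ι (N C k) * a (suc k)
  split : ∀ k → ι (suc N C suc k) * a (suc k) ≡ h k + g (suc k)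
  split k = begin
    ι (suc N C suc k) * a (suc k)            ≡⟨ cong (λ c → ι c * a (suc k)) (nCk+nC[k+1]≡[n+1]C[k+1] N k) ⟨
    ι (N C k ℕ.+ N C suc k) * a (suc k)      ≡⟨ cong (_* a (suc k)) (ι-+ (N C k) (N C suc k)) ⟩
    (ι (N C k) + ι (N C suc k)) * a (suc k)  ≡⟨ *-distribʳ-+ (a (suc k)) (ι (N C k)) (ι (N C suc k)) ⟩
    h k + g (suc k)                          ∎
  +-comm-middle : ∀ a b c → a + (b + c) ≡ b + (a + c)
  +-comm-middle = solve-∀ ℚ-ring
  prepend-g0 : g 0 + sumTo (suc N) (g ∘ suc) ≡ sumTo (suc N) g
  prepend-g0 = begin
    g 0 + sumTo (suc N) (g ∘ suc)     ≡⟨ sumTo-head (suc N) g ⟨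
    sumTo (suc N) g + g (suc N)       ≡⟨ cong (λ c → sumTo (suc N) g + ι c * a (suc N)) (k>n⇒nCk≡0 (ℕₚ.n<1+n N)) ⟩
    sumTo (suc N) g + 0ℚ * a (suc N)  ≡⟨ cong (λ s → sumTo (suc N) g + s) (*-zeroˡ (a (suc N))) ⟩
    sumTo (suc N) g + 0ℚ              ≡⟨ +-identityʳ _ ⟩
    sumTo (suc N) g                   ∎

Seq : Set
Seq = ℕ → ℚ

0ₛ : Seq
0ₛ _ = 0ℚ

_⊕_ : Seq → Seq → Seq
(x ⊕ y) m = x m + y m

D : Seq → Seq
D x m = ι m * x m - ι (suc m) * x (suc m)

D^ : ℕ → Seq → Seq
D^ zero    x = x
D^ (suc k) x = D^ k (D x)

E : Seq → Seq
E x zero    = x zero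
E x (suc m) = x (suc m) - x m

D-cong : ∀ {x y : Seq} → x ≗ y → D x ≗ D y
D-cong x≗y m = cong₂ (λ a b → ι m * a - ι (suc m) * b) (x≗y m) (x≗y (suc m))

D^-cong : ∀ k {x y : Seq} → x ≗ y → D^ k x ≗ D^ k y
D^-cong zero    x≗y = x≗y
D^-cong (suc k) x≗y = D^-cong k (D-cong x≗y)

D-⊕ : ∀ x y → D (x ⊕ y) ≗ D x ⊕ D y
D-⊕ x y m = distrib (ι m) (ι (suc m)) (x m) (x (suc m)) (y m) (y (suc m))
  where
  distrib : ∀ i j a b c d → i * (a + c) - j * (b + d) ≡ (i * a - j * b) + (i * c - j * d)
  distrib = solve-∀ ℚ-ring

D^-⊕ : ∀ k x y → D^ k (x ⊕ y) ≗ D^ k x ⊕ D^ k y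
D^-⊕ zero    x y m = refl
D^-⊕ (suc k) x y m = trans (D^-cong k (D-⊕ x y) m) (D^-⊕ k (D x) (D y) m)

D-0ₛ : D 0ₛ ≗ 0ₛ
D-0ₛ m = annihilate (ι m) (ι (suc m))
  where
  annihilate : ∀ i j → i * 0ℚ - j * 0ℚ ≡ 0ℚ
  annihilate = solve-∀ ℚ-ring

D^-0ₛ : ∀ k → D^ k 0ₛ ≗ 0ₛ
D^-0ₛ zero    m = refl
D^-0ₛ (suc k) m = trans (D^-cong k D-0ₛ m) (D^-0ₛ k m)

DE≗E[D+1] : ∀ x → D (E x) ≗ E (D x ⊕ x)
DE≗E[D+1] x zero = at-zero (x 0) (x 1)
  where
  at-zero : ∀ a b → 0ℚ * a - 1ℚ * (b - a) ≡ (0ℚ * a - 1ℚ * b) + a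
  at-zero = solve-∀ ℚ-ring
DE≗E[D+1] x (suc m) rewrite ι-suc (suc m) | ι-suc m = at-suc (ι m) (x m) (x (suc m)) (x (suc (suc m)))
  where
  at-suc : ∀ i a b c → (1ℚ + i) * (b - a) - (1ℚ + (1ℚ + i)) * (c - b)
                     ≡ ((1ℚ + i) * b - (1ℚ + (1ℚ + i)) * c + b) - (i * a - (1ℚ + i) * b + a)
  at-suc = solve-∀ ℚ-ring

D^-E-binomial : ∀ N x → D^ N (E x) 0 ≡ sumTo (suc N) (λ k → ι (N C k) * D^ k x 0)
D^-E-binomial zero    x = sym (trans (+-identityˡ _) (*-identityˡ (x 0)))
D^-E-binomial (suc N) x = begin
  D^ N (D (E x)) 0
    ≡⟨ D^-cong N (DE≗E[D+1] x) 0 ⟩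
  D^ N (E (D x ⊕ x)) 0
    ≡⟨ D^-E-binomial N (D x ⊕ x) ⟩
  sumTo (suc N) (λ k → ι (N C k) * D^ k (D x ⊕ x) 0)
    ≡⟨ sumTo-cong (suc N) (λ k → cong (ι (N C k) *_) (D^-⊕ k (D x) x 0)) ⟩
  sumTo (suc N) (λ k → ι (N C k) * (D^ (suc k) x 0 + D^ k x 0))
    ≡⟨ pascal-sum N (λ k → D^ k x 0) ⟨
  sumTo (suc (suc N)) (λ k → ι (suc N C k) * D^ k x 0)
    ∎
  where open ≡-Reasoning

stirling2-vanishes : ∀ n m → n ℕ.< m → stirling2 n m ≡ 0
stirling2-vanishes zero    (suc m) _           = refl
stirling2-vanishes (suc n) (suc m) (ℕ.s≤s n<m)
  rewrite stirling2-vanishes n (suc m) (ℕₚ.m<n⇒m<1+n n<m) | stirling2-vanishes n m n<m =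
  trans (ℕₚ.+-identityʳ (m ℕ.* 0)) (ℕₚ.*-zeroʳ m)

T : ℕ → ℕ → ℚ
T n m = sgn m * ι (m ! ℕ.* stirling2 n m)

T-vanishes : ∀ n → T n (suc n) ≡ 0ℚ
T-vanishes n rewrite stirling2-vanishes n (suc n) ℕₚ.≤-refl | ℕₚ.*-zeroʳ (suc n !) = *-zeroʳ (sgn (suc n))

T-rec : ∀ n m → T (suc n) (suc m) ≡ ι (suc m) * T n (suc m) - ι (suc m) * T n m
T-rec n m = begin
  - s * ι (M ℕ.* f ℕ.* (M ℕ.* p ℕ.+ q))
    ≡⟨ cong (λ t → - s * t) (trans (ι-* (M ℕ.* f) _)
         (cong₂ _*_ (ι-* M f) (trans (ι-+ (M ℕ.* p) q) (cong (_+ ι q) (ι-* M p))))) ⟩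
  - s * (ι M * ι f * (ι M * ι p + ι q))
    ≡⟨ regroup s (ι M) (ι f) (ι p) (ι q) ⟩
  ι M * (- s * (ι M * ι f * ι p)) - ι M * (s * (ι f * ι q))
    ≡⟨ cong₂ (λ u v → ι M * (- s * u) - ι M * (s * v)) (trans (ι-* (M ℕ.* f) p) (cong (_* ι p) (ι-* M f))) (ι-* f q) ⟨
  ι M * T n M - ι M * T n m
    ∎
  where
  open ≡-Reasoning
  s = sgn m
  M = suc m
  f = m !
  p = stirling2 n (suc m)
  q = stirling2 n m
  regroup : ∀ s m f p q → - s * (m * f * (m * p + q)) ≡ m * (- s * (m * f * p)) - m * (s * (f * q))
  regroup = solve-∀ ℚ-ring

stirling-transform-step : ∀ n x →
  sumTo (suc (suc n)) (λ m → T (suc n) m * x m) ≡ sumTo (suc n) (λ m → T n m * D x m)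
stirling-transform-step n x = begin
  sumTo (suc (suc n)) (λ m → T (suc n) m * x m)
    ≡⟨ sumTo-head (suc n) _ ⟩
  T (suc n) 0 * x 0 + sumTo (suc n) (λ m → T (suc n) (suc m) * x (suc m))
    ≡⟨ cong₂ _+_ (*-zeroˡ (x 0)) (sumTo-cong (suc n) (λ m → cong (_* x (suc m)) (T-rec n m))) ⟩
  0ℚ + sumTo (suc n) (λ m → (ι (suc m) * T n (suc m) - ι (suc m) * T n m) * x (suc m))
    ≡⟨ trans (+-identityˡ _) (sumTo-cong (suc n) (λ m → *-distribʳ-- (ι (suc m) * T n (suc m)) _ _)) ⟩
  sumTo (suc n) (λ m → g (suc m) - h m)
    ≡⟨ sumTo-- (suc n) (g ∘ suc) h ⟩
  sumTo (suc n) (g ∘ suc) - sumTo (suc n) h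
    ≡⟨ cong (_- sumTo (suc n) h) (sumTo-∘suc (suc n) g g-vanishes-at-0 g-vanishes-at-suc-n) ⟩
  sumTo (suc n) g - sumTo (suc n) h
    ≡⟨ sumTo-- (suc n) g h ⟨
  sumTo (suc n) (λ m → g m - h m)
    ≡⟨ sumTo-cong (suc n) (λ m → factor (ι m) (ι (suc m)) (T n m) (x m) (x (suc m))) ⟩
  sumTo (suc n) (λ m → T n m * D x m)
    ∎
  where
  open ≡-Reasoning
  g h : ℕ → ℚ
  g m = ι m * T n m * x m
  h m = ι (suc m) * T n m * x (suc m)
  g-vanishes-at-0 : g 0 ≡ 0ℚ
  g-vanishes-at-0 = trans (cong (_* x 0) (*-zeroˡ (T n 0))) (*-zeroˡ (x 0))
  g-vanishes-at-suc-n : g (suc n) ≡ 0ℚ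
  g-vanishes-at-suc-n rewrite T-vanishes n | *-zeroʳ (ι (suc n)) = *-zeroˡ (x (suc n))
  *-distribʳ-- : ∀ a b c → (a - b) * c ≡ a * c - b * c
  *-distribʳ-- = solve-∀ ℚ-ring
  factor : ∀ i j t a b → i * t * a - j * t * b ≡ t * (i * a - j * b)
  factor = solve-∀ ℚ-ring

stirling-transform : ∀ n x → sumTo (suc n) (λ m → T n m * x m) ≡ D^ n x 0
stirling-transform zero    x = trans (+-identityˡ _) (*-identityˡ (x 0))
stirling-transform (suc n) x = trans (stirling-transform-step n x) (stirling-transform n (D x))

-- The recurrence step of bernoulliList, which Defs keeps private; both sides unfold to the same term.
bernoulliStep : ℕ → List ℚ → ℚ
bernoulliStep m bs = - (1/ι (suc m) * foldr _+_ 0ℚ (map (λ p → ι (suc m C proj₁ p) * proj₂ p) (zip (upTo m) bs)))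

last-∷ʳ : ∀ xs (x : ℚ) → last (xs ∷ʳ x) ≡ x
last-∷ʳ []           x = refl
last-∷ʳ (_ ∷ [])     x = refl
last-∷ʳ (_ ∷ y ∷ xs) x = last-∷ʳ (y ∷ xs) x

last-applyUpTo : ∀ (f : ℕ → ℚ) n → last (applyUpTo f (suc n)) ≡ f n
last-applyUpTo f n = trans (cong last (sym (applyUpTo-∷ʳ f n))) (last-∷ʳ (applyUpTo f n) (f n))

foldr-zip-applyUpTo : ∀ N n (f : ℕ → ℕ) (β : ℕ → ℚ) →
  foldr _+_ 0ℚ (map (λ p → ι (N C proj₁ p) * proj₂ p) (zip (applyUpTo f n) (applyUpTo (β ∘ f) n)))
    ≡ sumTo n (λ k → ι (N C f k) * β (f k))
foldr-zip-applyUpTo N zero    f β = refl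
foldr-zip-applyUpTo N (suc n) f β =
  trans (cong (λ t → ι (N C f 0) * β (f 0) + t) (foldr-zip-applyUpTo N n (f ∘ suc) β)) (sym (sumTo-head n _))

bernoulli-unique : ∀ (β : ℕ → ℚ) → β 0 ≡ 1ℚ →
  (∀ m → sumTo (suc (suc m)) (λ k → ι (suc (suc m) C k) * β k) ≡ 0ℚ) → ∀ m → bernoulli m ≡ β m
bernoulli-unique β β0≡1 recurrence m = trans (cong last (bernoulliList≡ m)) (last-applyUpTo β m)
  where
  open ≡-Reasoning
  β-step : ∀ m → β (suc m) ≡ bernoulliStep (suc m) (applyUpTo β (suc m))
  β-step m = begin
    β (suc m)
      ≡⟨ s+ax≡0⇒x≡-a⁻¹s {ι (suc M)} {1/ι (suc M)} (ι-*-1/ι (suc m)) recurrence-split ⟩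
    - (1/ι (suc M) * S)
      ≡⟨ cong (λ t → - (1/ι (suc M) * t)) (foldr-zip-applyUpTo (suc M) (suc m) (λ k → k) β) ⟨
    bernoulliStep (suc m) (applyUpTo β (suc m))
      ∎
    where
    M = suc m
    S = sumTo M (λ k → ι (suc M C k) * β k)
    recurrence-split : S + ι (suc M) * β M ≡ 0ℚ
    recurrence-split = trans (cong (λ r → S + ι r * β M) (sym ([n+1]Cn≡n+1 M))) (recurrence m)
  bernoulliList≡ : ∀ m → bernoulliList m ≡ applyUpTo β (suc m)
  bernoulliList≡ zero    = cong (_∷ []) (sym β0≡1)
  bernoulliList≡ (suc m) = begin
    bernoulliList m ∷ʳ bernoulliStep (suc m) (bernoulliList m)
      ≡⟨ cong (λ bs → bs ∷ʳ bernoulliStep (suc m) bs) (bernoulliList≡ m) ⟩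
    applyUpTo β (suc m) ∷ʳ bernoulliStep (suc m) (applyUpTo β (suc m))
      ≡⟨ cong (applyUpTo β (suc m) ∷ʳ_) (β-step m) ⟨
    applyUpTo β (suc m) ∷ʳ β (suc m)
      ≡⟨ applyUpTo-∷ʳ β (suc m) ⟩
    applyUpTo β (suc (suc m))
      ∎

harmonic : ℕ → ℚ
harmonic m = sumTo m (λ i → 1/ι (suc i))

harmonic/suc : Seq
harmonic/suc m = harmonic m * 1/ι (suc m)

c : ℕ → ℚ
c n = D^ n harmonic/suc 0

lagNeg : Seq → Seq
lagNeg x zero    = 0ℚ
lagNeg x (suc m) = - x m

E≗⊕lagNeg : ∀ x → E x ≗ x ⊕ lagNeg x
E≗⊕lagNeg x zero    = sym (+-identityʳ (x 0))
E≗⊕lagNeg x (suc m) = refl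

D³-lagNeg-harmonic/suc : D (D (D (lagNeg harmonic/suc))) ≗ 0ₛ
D³-lagNeg-harmonic/suc m = trans (D-cong (D-cong D-lagNeg) m) (trans (D-cong D-reciprocals m) (D-negδ₀ m))
  where
  reciprocals negδ₀ : Seq
  reciprocals zero    = 0ℚ
  reciprocals (suc m) = 1/ι (suc m)
  negδ₀ zero    = - 1ℚ
  negδ₀ (suc m) = 0ℚ

  D-lagNeg : D (lagNeg harmonic/suc) ≗ reciprocals
  D-lagNeg zero    = refl
  D-lagNeg (suc m) = telescope (ι (suc m)) (1/ι (suc m)) (ι (suc (suc m))) (1/ι (suc (suc m))) (harmonic m)
                               (ι-*-1/ι m) (ι-*-1/ι (suc m))
    where
    telescope : ∀ a a⁻¹ b b⁻¹ h → a * a⁻¹ ≡ 1ℚ → b * b⁻¹ ≡ 1ℚ →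
                a * (- (h * a⁻¹)) - b * (- ((h + a⁻¹) * b⁻¹)) ≡ a⁻¹
    telescope a a⁻¹ b b⁻¹ h aa⁻¹≡1 bb⁻¹≡1 = begin
      a * (- (h * a⁻¹)) - b * (- ((h + a⁻¹) * b⁻¹))  ≡⟨ regroup a a⁻¹ b b⁻¹ h ⟩
      (- h) * (a * a⁻¹) + (h + a⁻¹) * (b * b⁻¹)      ≡⟨ cong₂ (λ u v → (- h) * u + (h + a⁻¹) * v) aa⁻¹≡1 bb⁻¹≡1 ⟩
      (- h) * 1ℚ + (h + a⁻¹) * 1ℚ                    ≡⟨ cancel h a⁻¹ ⟩
      a⁻¹                                            ∎
      where
      open ≡-Reasoning
      regroup : ∀ a a⁻¹ b b⁻¹ h →
                a * (- (h * a⁻¹)) - b * (- ((h + a⁻¹) * b⁻¹)) ≡ (- h) * (a * a⁻¹) + (h + a⁻¹) * (b * b⁻¹)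
      regroup = solve-∀ ℚ-ring
      cancel : ∀ h a⁻¹ → (- h) * 1ℚ + (h + a⁻¹) * 1ℚ ≡ a⁻¹
      cancel = solve-∀ ℚ-ring

  D-reciprocals : D reciprocals ≗ negδ₀
  D-reciprocals zero    = refl
  D-reciprocals (suc m) = cong₂ _-_ (ι-*-1/ι m) (ι-*-1/ι (suc m))

  D-negδ₀ : D negδ₀ ≗ 0ₛ
  D-negδ₀ zero    = refl
  D-negδ₀ (suc m) = D-0ₛ (suc m)

binomial-c-vanishes : ∀ k → sumTo (3 ℕ.+ k) (λ j → ι ((3 ℕ.+ k) C j) * c j) ≡ 0ℚ
binomial-c-vanishes k = begin
  S
    ≡⟨ add-sub S (c N) ⟩
  (S + 1ℚ * c N) - c N
    ≡⟨ cong (λ r → (S + ι r * c N) - c N) (nCn≡1 N) ⟨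
  (S + ι (N C N) * c N) - c N
    ≡⟨ cong (_- c N) (D^-E-binomial N harmonic/suc) ⟨
  D^ N (E harmonic/suc) 0 - c N
    ≡⟨ cong (_- c N) (trans (D^-cong N (E≗⊕lagNeg harmonic/suc) 0) (D^-⊕ N harmonic/suc _ 0)) ⟩
  (c N + D^ N (lagNeg harmonic/suc) 0) - c N
    ≡⟨ cong (λ r → (c N + r) - c N) (trans (D^-cong k D³-lagNeg-harmonic/suc 0) (D^-0ₛ k 0)) ⟩
  (c N + 0ℚ) - c N
    ≡⟨ add-zero-sub (c N) ⟩
  0ℚ
    ∎
  where
  open ≡-Reasoning
  N = 3 ℕ.+ k
  S = sumTo N (λ j → ι (N C j) * c j)
  add-sub : ∀ s t → s ≡ (s + 1ℚ * t) - t
  add-sub = solve-∀ ℚ-ring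
  add-zero-sub : ∀ t → (t + 0ℚ) - t ≡ 0ℚ
  add-zero-sub = solve-∀ ℚ-ring

b : ℕ → ℚ
b k = - (ι 2 * (1/ι (suc k) * c (suc k)))

b0≡1 : b 0 ≡ 1ℚ
b0≡1 = refl

b-recurrence : ∀ m → sumTo (suc (suc m)) (λ k → ι (suc (suc m) C k) * b k) ≡ 0ℚ
b-recurrence m = begin
  sumTo N (λ k → ι (N C k) * b k)                               ≡⟨ sumTo-cong N absorb ⟩
  sumTo N (λ k → - (ι 2 * 1/ι (suc N)) * g (suc k))             ≡⟨ sumTo-*ˡ N (- (ι 2 * 1/ι (suc N))) (g ∘ suc) ⟩
  - (ι 2 * 1/ι (suc N)) * sumTo N (g ∘ suc)                     ≡⟨ cong (λ t → - (ι 2 * 1/ι (suc N)) * t) shifted-sum ⟩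
  - (ι 2 * 1/ι (suc N)) * 0ℚ                                    ≡⟨ *-zeroʳ (- (ι 2 * 1/ι (suc N))) ⟩
  0ℚ                                                            ∎
  where
  open ≡-Reasoning
  N = suc (suc m)
  g : ℕ → ℚ
  g j = ι (suc N C j) * c j
  absorb : ∀ k → ι (N C k) * b k ≡ - (ι 2 * 1/ι (suc N)) * g (suc k)
  absorb k = begin
    ι (N C k) * - (ι 2 * (1/ι (suc k) * c (suc k)))
      ≡⟨ regroup (ι (N C k)) (ι 2) (1/ι (suc k)) (c (suc k)) ⟩
    - (ι 2 * (ι (N C k) * 1/ι (suc k)) * c (suc k))
      ≡⟨ cong (λ r → - (ι 2 * r * c (suc k))) (ι-C-absorption N k) ⟩
    - (ι 2 * (ι (suc N C suc k) * 1/ι (suc N)) * c (suc k))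
      ≡⟨ regroup′ (ι 2) (ι (suc N C suc k)) (1/ι (suc N)) (c (suc k)) ⟩
    - (ι 2 * 1/ι (suc N)) * g (suc k)
      ∎
    where
    regroup : ∀ p t i x → p * - (t * (i * x)) ≡ - (t * (p * i) * x)
    regroup = solve-∀ ℚ-ring
    regroup′ : ∀ t q i x → - (t * (q * i) * x) ≡ - (t * i) * (q * x)
    regroup′ = solve-∀ ℚ-ring
  shifted-sum : sumTo N (g ∘ suc) ≡ 0ℚ
  shifted-sum = begin
    sumTo N (g ∘ suc)         ≡⟨ +-identityˡ _ ⟨
    0ℚ + sumTo N (g ∘ suc)    ≡⟨ sumTo-head N g ⟨    -- g 0 = c 0 = 0 by evaluation
    sumTo (suc N) g           ≡⟨ binomial-c-vanishes m ⟩
    0ℚ                        ∎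

summand : ℕ → ℕ → ℕ → ℚ
summand n m l = sgn m * (ι (m ! ℕ.* stirling2 n m) * 1/ι (suc m ℕ.* suc l))

row-sum : ∀ n m → sumTo m (summand n m) ≡ T n m * harmonic/suc m
row-sum n m = begin
  sumTo m (λ l → sgn m * (ι P * 1/ι (suc m ℕ.* suc l)))
    ≡⟨ sumTo-cong m (λ l → cong (λ r → sgn m * (ι P * r)) (1/ι-* m l)) ⟩
  sumTo m (λ l → sgn m * (ι P * (1/ι (suc m) * 1/ι (suc l))))
    ≡⟨ sumTo-cong m (λ l → regroup (sgn m) (ι P) (1/ι (suc m)) (1/ι (suc l))) ⟩
  sumTo m (λ l → T n m * 1/ι (suc m) * 1/ι (suc l))
    ≡⟨ sumTo-*ˡ m (T n m * 1/ι (suc m)) (λ l → 1/ι (suc l)) ⟩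
  T n m * 1/ι (suc m) * harmonic m
    ≡⟨ regroup′ (T n m) (1/ι (suc m)) (harmonic m) ⟩
  T n m * harmonic/suc m
    ∎
  where
  open ≡-Reasoning
  P = m ! ℕ.* stirling2 n m
  regroup : ∀ s p i j → s * (p * (i * j)) ≡ s * p * i * j
  regroup = solve-∀ ℚ-ring
  regroup′ : ∀ t i h → t * i * h ≡ t * (h * i)
  regroup′ = solve-∀ ℚ-ring

double-sum≡c : ∀ n → sumTo n (λ i → sumTo (suc i) (λ j → summand n (n ∸ j) (i ∸ j))) ≡ c n
double-sum≡c n = begin
  sumTo n (λ i → sumTo (suc i) (λ j → summand n (n ∸ j) (i ∸ j)))
    ≡⟨ sumTo-triangle n (λ j → summand n (n ∸ j)) ⟩
  sumTo n (λ j → sumTo (n ∸ j) (summand n (n ∸ j)))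
    ≡⟨ sumTo-reflect n (λ m → sumTo m (summand n m)) ⟩
  sumTo n (λ m → sumTo (suc m) (summand n (suc m)))
    ≡⟨ sumTo-cong n (λ m → row-sum n (suc m)) ⟩
  sumTo n (λ m → T n (suc m) * harmonic/suc (suc m))
    ≡⟨ trans (sumTo-head n _) (trans (cong (_+ tail) (*-zeroʳ (T n 0))) (+-identityˡ tail)) ⟨
  sumTo (suc n) (λ m → T n m * harmonic/suc m)
    ≡⟨ stirling-transform n harmonic/suc ⟩
  c n
    ∎
  where
  open ≡-Reasoning
  tail = sumTo n (λ m → T n (suc m) * harmonic/suc (suc m))

c≡-[n/2]b : ∀ k → c (suc k) ≡ - ((+ suc k / 2) * b k)
c≡-[n/2]b k = begin
  c n                                          ≡⟨ *-identityˡ-twice (c n) ⟨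
  1ℚ * 1ℚ * c n                                ≡⟨ cong₂ (λ u v → u * v * c n) (ι-*-1/ι k) (ι-*-1/ι 1) ⟨
  ι n * 1/ι n * (ι 2 * 1/ι 2) * c n            ≡⟨ regroup (ι n) (1/ι n) (ι 2) (1/ι 2) (c n) ⟩
  - (ι n * 1/ι 2 * - (ι 2 * (1/ι n * c n)))    ≡⟨ cong (λ r → - (r * b k)) (/≡ι*1/ι n 1) ⟨
  - ((+ n / 2) * b k)                          ∎
  where
  open ≡-Reasoning
  n = suc k
  *-identityˡ-twice : ∀ x → 1ℚ * 1ℚ * x ≡ x
  *-identityˡ-twice = solve-∀ ℚ-ring
  regroup : ∀ a a⁻¹ t t⁻¹ x → a * a⁻¹ * (t * t⁻¹) * x ≡ - (a * t⁻¹ * - (t * (a⁻¹ * x)))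
  regroup = solve-∀ ℚ-ring

proposition7 : (n : ℕ) → .{{_ : ℕ.NonZero n}} →
    sumTo n (λ i → sumTo (suc i) (λ j →
        sgn (n ∸ j) * ((+ ((n ∸ j) ! ℕ.* stirling2 n (n ∸ j)) / 1)
          * (+ 1 / ((suc (n ∸ j)) ℕ.* suc (i ∸ j))))))
      ≡ - ((+ n / 2) * bernoulli (n ∸ 1))
proposition7 (suc k) = begin
  sumTo (suc k) (λ i → sumTo (suc i) (λ j → summand (suc k) (suc k ∸ j) (i ∸ j)))
    ≡⟨ double-sum≡c (suc k) ⟩
  c (suc k)
    ≡⟨ c≡-[n/2]b k ⟩
  - ((+ suc k / 2) * b k)
    ≡⟨ cong (λ β → - ((+ suc k / 2) * β)) (bernoulli-unique b b0≡1 b-recurrence k) ⟨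
  - ((+ suc k / 2) * bernoulli k)
    ∎
  where open ≡-Reasoning
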